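{- Let $n,d$ be positive integers and let $a_{d}$ be the number of isomorphism classes of abelian groups of order at most $d$. For every finite abelian group $A$ of rank at most $n$, the number of subgroups $B\subset A$ with $|A|\le d|B|$ (i.e. of index at most $d$) is at most $d^{n}a_{d}$.
   Context: The rank of a finite abelian group is the minimal number of generators. -}

module Defs where

open import Data.Nat using (ℕ; _≤_; _*_; _^_)
open import Data.Fin using (Fin)
open import Data.Fin.Subset using (Subset; _∈_; ∣_∣)
open import Data.List using (List; length)
open import Data.List.Relation.Unary.All using (All)
open import Data.List.Relation.Unary.Any using (Any)
open import Data.List.Relation.Unary.Unique.Propositional using (Unique)
open import Data.List.Relation.Unary.AllPairs using (AllPairs)
open import Data.Product using (Σ; ∃; _×_)
open import Relation.Binary.PropositionalEquality using (_≡_)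
open import Relation.Nullary using (¬_)

-- A finite abelian group, presented (up to isomorphism, w.l.o.g.) on the
-- carrier Fin order, with propositional equality.
record FinAbGroup : Set where
  field
    order : ℕ
    _∙_   : Fin order → Fin order → Fin order
    ε     : Fin order
    _⁻¹   : Fin order → Fin order
    assoc    : ∀ x y z → (x ∙ y) ∙ z ≡ x ∙ (y ∙ z)
    comm     : ∀ x y → x ∙ y ≡ y ∙ x
    identityˡ : ∀ x → ε ∙ x ≡ x
    inverseˡ  : ∀ x → (x ⁻¹) ∙ x ≡ ε

open FinAbGroup public

IsSubgroup : (A : FinAbGroup) → Subset (order A) → Set
IsSubgroup A S =
  (ε A ∈ S) ×
  (∀ x y → x ∈ S → y ∈ S → _∙_ A x y ∈ S) ×
  (∀ x → x ∈ S → _⁻¹ A x ∈ S)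

InGenerated : (A : FinAbGroup) → List (Fin (order A)) → Fin (order A) → Set
InGenerated A gs x = ∀ S → IsSubgroup A S → All (λ g → g ∈ S) gs → x ∈ S

-- rank A ≤ n: A is generated by at most n elements.
RankAtMost : ℕ → FinAbGroup → Set
RankAtMost n A = Σ (List (Fin (order A))) λ gs →
  (length gs ≤ n) × (∀ x → InGenerated A gs x)

_≅_ : FinAbGroup → FinAbGroup → Set
A ≅ B = Σ (Fin (order A) → Fin (order B)) λ f →
        Σ (Fin (order B) → Fin (order A)) λ g →
        (∀ x → g (f x) ≡ x) × (∀ y → f (g y) ≡ y) ×
        (∀ x y → f (_∙_ A x y) ≡ _∙_ B (f x) (f y))

-- N is the number of isomorphism classes of abelian groups of order ≤ d,
-- witnessed by a complete list of pairwise non-isomorphic representatives.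
IsoClassReps : ℕ → List FinAbGroup → Set
IsoClassReps d reps =
  All (λ G → order G ≤ d) reps ×
  AllPairs (λ G H → ¬ (G ≅ H)) reps ×
  (∀ G → order G ≤ d → Any (λ H → G ≅ H) reps)

SubgroupsOfIndexAtMost : (d : ℕ) (A : FinAbGroup) → List (Subset (order A)) → Set
SubgroupsOfIndexAtMost d A Bs =
  Unique Bs × All (λ B → IsSubgroup A B × (order A ≤ d * ∣ B ∣)) Bs

module Submission where

-- If B has index at most d then, by Lagrange, |A/B| ≤ d, so A/B is isomorphic to one of the
-- representatives C_i, and composing gives a homomorphism φ : A → C_i with kernel B. As A is
-- generated by gs, φ is determined by the images of gs, each an element of a group of order at most d.
-- So B is determined by i together with a map from gs to Fin d: there are at most
-- |reps| · d^|gs| ≤ |reps| · d^n such data.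

open import Defs
open import Algebra.Bundles using (AbelianGroup; Group)
open import Algebra.Consequences.Propositional using (comm∧idˡ⇒id; comm∧invˡ⇒inv)
import Algebra.Properties.AbelianGroup as AbelianGroupProperties
import Algebra.Properties.CommutativeSemigroup as CommutativeSemigroupProperties
import Algebra.Properties.Group as GroupProperties
open import Level using (0ℓ)
open import Data.Nat using (ℕ; _≤_; _*_; _^_; _≥_; >-nonZero)
open import Data.Nat.Properties using (≤-trans; *-cancelʳ-≤; *-monoʳ-≤; ^-monoʳ-≤; *-comm; module ≤-Reasoning)
open import Data.Fin using (Fin; zero; suc; _≟_; combine; remQuot; inject≤; funToFin; finToFun)
open import Data.Fin.Properties
  using (suc-injective; injective⇒≤; combine-remQuot; combine-injectiveˡ; combine-injectiveʳ; inject≤-injective; finToFun-funToFin)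
open import Data.Fin.Subset using (Subset; inside; outside; _∈_; _⊆_; ∣_∣)
open import Data.Fin.Subset.Properties using (_∈?_; ⊆-antisym; p⊆q⇒∣p∣≤∣q∣; ∣⁅x⁆∣≡1; x∈⁅y⁆⇒x≡y)
open import Data.Vec using (_∷_; here; there; tabulate)
open import Data.Vec.Properties using ([]=⇒lookup; lookup⇒[]=; lookup∘tabulate)
open import Data.List using (List; length; lookup; allFin; deduplicate)
open import Data.List.Membership.Propositional.Properties using (∈-lookup; ∈-allFin)
open import Data.List.Relation.Unary.All as All using (All)
open import Data.List.Relation.Unary.AllPairs using (_∷_)
open import Data.List.Relation.Unary.Any as Any using (Any)
open import Data.List.Relation.Unary.Any.Properties using (lookup-index; deduplicate⁺)
open import Data.List.Relation.Unary.Unique.DecSetoid.Properties using (deduplicate-!)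
open import Data.List.Relation.Unary.Unique.Propositional using (Unique)
import Data.List.Relation.Unary.Unique.Setoid as UniqueSetoid
open import Data.Product using (∃; _×_; _,_; proj₁; proj₂; uncurry)
open import Function using (_∘_; _⇔_; mk⇔; Equivalence; Injective)
open import Relation.Binary.Bundles using (Setoid; DecSetoid)
open import Relation.Binary.PropositionalEquality
open import Relation.Nullary using (Dec; contradiction; yes; does)
open import Relation.Nullary.Decidable using (dec-true)
open import Relation.Unary using (Pred; Decidable)

module _ {a ℓ} (S : Setoid a ℓ) where
  open Setoid S using (_≈_)

  lookup-injective : ∀ {xs} → UniqueSetoid.Unique S xs → ∀ {i j} → lookup xs i ≈ lookup xs j → i ≡ j
  lookup-injective (_ ∷ _) {zero} {zero} _ = refl
  lookup-injective (x≉ ∷ _) {zero} {suc j} x≈ = contradiction x≈ (All.lookup x≉ (∈-lookup j))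
  lookup-injective (x≉ ∷ _) {suc i} {zero} ≈x = contradiction (Setoid.sym S ≈x) (All.lookup x≉ (∈-lookup i))
  lookup-injective (_ ∷ xs!) {suc i} {suc j} eq = cong suc (lookup-injective xs! eq)

unique-length≤ : ∀ {a p} {A : Set a} {P : Pred A p} {xs : List A} {n} (code : ∀ {x} → P x → Fin n) →
                 (∀ {x y} (px : P x) (py : P y) → code px ≡ code py → x ≡ y) →
                 Unique xs → All P xs → length xs ≤ n
unique-length≤ {P = P} {xs} code code-injective xs! pxs =
  injective⇒≤ {f = code ∘ P-at} (lookup-injective (setoid _) xs! ∘ code-injective (P-at _) (P-at _))
  where
  P-at : ∀ i → P (lookup xs i)
  P-at i = All.lookup pxs (∈-lookup {xs = xs} i)

*-injective⇒≤ : ∀ {m n o} (f : Fin m → Fin n → Fin o) →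
                (∀ {a b a′ b′} → f a b ≡ f a′ b′ → a ≡ a′ × b ≡ b′) → m * n ≤ o
*-injective⇒≤ {m} {n} f f-injective = injective⇒≤ {f = uncurry f ∘ remQuot {m} n} λ {i} {j} eq →
  let a≡a′ , b≡b′ = f-injective eq in
  begin
    i                                 ≡⟨ combine-remQuot {m} n i ⟨
    uncurry combine (remQuot {m} n i) ≡⟨ cong₂ combine a≡a′ b≡b′ ⟩
    uncurry combine (remQuot {m} n j) ≡⟨ combine-remQuot {m} n j ⟩
    j                                 ∎
  where open ≡-Reasoning

enumerate : ∀ {n} (p : Subset n) → Fin ∣ p ∣ → Fin n
enumerate (inside  ∷ p) zero    = zero
enumerate (inside  ∷ p) (suc i) = suc (enumerate p i)
enumerate (outside ∷ p) i       = suc (enumerate p i)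

enumerate-∈ : ∀ {n} (p : Subset n) i → enumerate p i ∈ p
enumerate-∈ (inside  ∷ p) zero    = here
enumerate-∈ (inside  ∷ p) (suc i) = there (enumerate-∈ p i)
enumerate-∈ (outside ∷ p) i       = there (enumerate-∈ p i)

enumerate-injective : ∀ {n} (p : Subset n) → Injective _≡_ _≡_ (enumerate p)
enumerate-injective (inside  ∷ p) {zero}  {zero}  _  = refl
enumerate-injective (inside  ∷ p) {suc i} {suc j} eq = cong suc (enumerate-injective p (suc-injective eq))
enumerate-injective (outside ∷ p) eq = enumerate-injective p (suc-injective eq)

module _ {n p} {P : Pred (Fin n) p} (P? : Decidable P) where

  subset : Subset n
  subset = tabulate (does ∘ P?)

  ∈-subset⁺ : ∀ {x} → P x → x ∈ subset
  ∈-subset⁺ {x} px = lookup⇒[]= x subset (trans (lookup∘tabulate (does ∘ P?) x) (dec-true (P? x) px))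

  ∈-subset⁻ : ∀ {x} → x ∈ subset → P x
  ∈-subset⁻ {x} x∈ with P? x | trans (sym (lookup∘tabulate (does ∘ P?) x)) ([]=⇒lookup x∈)
  ... | yes px | _ = px

abelianGroup : FinAbGroup → AbelianGroup 0ℓ 0ℓ
abelianGroup G = record
  { isAbelianGroup = record
    { isGroup = record
      { isMonoid = record
        { isSemigroup = record
          { isMagma = record { isEquivalence = isEquivalence ; ∙-cong = cong₂ (_∙_ G) }
          ; assoc = assoc G }
        ; identity = comm∧idˡ⇒id (comm G) (identityˡ G) }
      ; inverse = comm∧invˡ⇒inv (comm G) (inverseˡ G)
      ; ⁻¹-cong = cong (_⁻¹ G) }
    ; comm = comm G } }

record IsHomomorphism (A C : FinAbGroup) (φ : Fin (order A) → Fin (order C)) : Set where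
  constructor isHomomorphism
  private
    module A = FinAbGroup A
    module C = FinAbGroup C
  field
    ∙-homo : ∀ x y → φ (x A.∙ y) ≡ φ x C.∙ φ y

module _ {A C : FinAbGroup} {φ : Fin (order A) → Fin (order C)} (φ-homo : IsHomomorphism A C φ) where
  private
    module A = AbelianGroup (abelianGroup A)
    module C = AbelianGroup (abelianGroup C)
    open GroupProperties C.group using (identityʳ-unique; inverseʳ-unique)
    open IsHomomorphism φ-homo

  ε-homo : φ A.ε ≡ C.ε
  ε-homo = identityʳ-unique (φ A.ε) (φ A.ε) (trans (sym (∙-homo A.ε A.ε)) (cong φ (A.identityˡ A.ε)))

  ⁻¹-homo : ∀ x → φ (x A.⁻¹) ≡ φ x C.⁻¹
  ⁻¹-homo x = inverseʳ-unique (φ x) (φ (x A.⁻¹))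
    (trans (sym (∙-homo x (x A.⁻¹))) (trans (cong φ (A.inverseʳ x)) ε-homo))

module _ {A C : FinAbGroup} {φ ψ : Fin (order A) → Fin (order C)}
         (φ-homo : IsHomomorphism A C φ) (ψ-homo : IsHomomorphism A C ψ) where
  private
    module A = FinAbGroup A
    module C = FinAbGroup C

    φ≟ψ : ∀ x → Dec (φ x ≡ ψ x)
    φ≟ψ x = φ x ≟ ψ x

  equalizer : Subset (order A)
  equalizer = subset φ≟ψ

  equalizer-isSubgroup : IsSubgroup A equalizer
  equalizer-isSubgroup =
    ∈-subset⁺ φ≟ψ (trans (ε-homo φ-homo) (sym (ε-homo ψ-homo))) ,
    (λ x y x∈ y∈ → ∈-subset⁺ φ≟ψ (begin
      φ (x A.∙ y)     ≡⟨ IsHomomorphism.∙-homo φ-homo x y ⟩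
      φ x C.∙ φ y     ≡⟨ cong₂ C._∙_ (∈-subset⁻ φ≟ψ x∈) (∈-subset⁻ φ≟ψ y∈) ⟩
      ψ x C.∙ ψ y     ≡⟨ IsHomomorphism.∙-homo ψ-homo x y ⟨
      ψ (x A.∙ y)     ∎)) ,
    (λ x x∈ → ∈-subset⁺ φ≟ψ (begin
      φ (x A.⁻¹)      ≡⟨ ⁻¹-homo φ-homo x ⟩
      φ x C.⁻¹        ≡⟨ cong C._⁻¹ (∈-subset⁻ φ≟ψ x∈) ⟩
      ψ x C.⁻¹        ≡⟨ ⁻¹-homo ψ-homo x ⟨
      ψ (x A.⁻¹)      ∎))
    where open ≡-Reasoning

  agree-on-generated : ∀ {gs x} → All (λ g → φ g ≡ ψ g) gs → InGenerated A gs x → φ x ≡ ψ x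
  agree-on-generated φ≡ψ x∈⟨gs⟩ =
    ∈-subset⁻ φ≟ψ (x∈⟨gs⟩ equalizer equalizer-isSubgroup (All.map (∈-subset⁺ φ≟ψ) φ≡ψ))

∘-isHomomorphism : ∀ {A B C f g} → IsHomomorphism B C f → IsHomomorphism A B g → IsHomomorphism A C (f ∘ g)
∘-isHomomorphism {f = f} f-homo g-homo = isHomomorphism λ x y →
  trans (cong f (IsHomomorphism.∙-homo g-homo x y)) (IsHomomorphism.∙-homo f-homo _ _)

module _ (A : FinAbGroup) {k : ℕ} (π : Fin (order A) → Fin k) (σ : Fin k → Fin (order A))
         (π∘σ : ∀ a → π (σ a) ≡ a)
         (π-cong : ∀ {x x′ y y′} → π x ≡ π x′ → π y ≡ π y′ →
                   π (_∙_ A x y) ≡ π (_∙_ A x′ y′)) where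
  private
    module A = AbelianGroup (abelianGroup A)
    open ≡-Reasoning

    _⋆_ : Fin k → Fin k → Fin k
    a ⋆ b = π (σ a A.∙ σ b)

    π-∙-homo : ∀ x y → π (x A.∙ y) ≡ π x ⋆ π y
    π-∙-homo x y = π-cong (sym (π∘σ (π x))) (sym (π∘σ (π y)))

    π-surjective : ∀ a → ∃ λ x → π x ≡ a
    π-surjective a = σ a , π∘σ a

    ⋆-assoc : ∀ a b c → (a ⋆ b) ⋆ c ≡ a ⋆ (b ⋆ c)
    ⋆-assoc a b c with x , refl ← π-surjective a | y , refl ← π-surjective b | z , refl ← π-surjective c =
      begin
        (π x ⋆ π y) ⋆ π z   ≡⟨ cong (_⋆ π z) (π-∙-homo x y) ⟨
        π (x A.∙ y) ⋆ π z   ≡⟨ π-∙-homo (x A.∙ y) z ⟨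
        π ((x A.∙ y) A.∙ z) ≡⟨ cong π (A.assoc x y z) ⟩
        π (x A.∙ (y A.∙ z)) ≡⟨ π-∙-homo x (y A.∙ z) ⟩
        π x ⋆ π (y A.∙ z)   ≡⟨ cong (π x ⋆_) (π-∙-homo y z) ⟩
        π x ⋆ (π y ⋆ π z)   ∎

    ⋆-comm : ∀ a b → a ⋆ b ≡ b ⋆ a
    ⋆-comm a b = cong π (A.comm (σ a) (σ b))

    ⋆-identityˡ : ∀ a → π A.ε ⋆ a ≡ a
    ⋆-identityˡ a with x , refl ← π-surjective a =
      trans (sym (π-∙-homo A.ε x)) (cong π (A.identityˡ x))

    ⋆-inverseˡ : ∀ a → π (σ a A.⁻¹) ⋆ a ≡ π A.ε
    ⋆-inverseˡ a = begin
      π (σ a A.⁻¹) ⋆ a         ≡⟨ cong (π (σ a A.⁻¹) ⋆_) (π∘σ a) ⟨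
      π (σ a A.⁻¹) ⋆ π (σ a)   ≡⟨ π-∙-homo (σ a A.⁻¹) (σ a) ⟨
      π (σ a A.⁻¹ A.∙ σ a)     ≡⟨ cong π (A.inverseˡ (σ a)) ⟩
      π A.ε                    ∎

  inducedGroup : FinAbGroup
  inducedGroup = record
    { order = k ; _∙_ = _⋆_ ; ε = π A.ε ; _⁻¹ = λ a → π (σ a A.⁻¹)
    ; assoc = ⋆-assoc ; comm = ⋆-comm ; identityˡ = ⋆-identityˡ ; inverseˡ = ⋆-inverseˡ }

  π-isHomomorphism : IsHomomorphism A inducedGroup π
  π-isHomomorphism = isHomomorphism π-∙-homo

module Quotient (A : FinAbGroup) {B : Subset (order A)} (B-subgroup : IsSubgroup A B) where
  private
    module A = AbelianGroup (abelianGroup A)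
    open Group A.group using (_\\_)
    open GroupProperties A.group using (⁻¹-anti-homo-\\; \\-leftDividesˡ; \\-leftDividesʳ; ∙-cancelˡ; ε⁻¹≈ε)
    open AbelianGroupProperties (abelianGroup A) using (⁻¹-∙-comm)
    open CommutativeSemigroupProperties A.commutativeSemigroup using (interchange)

    ε∈B : A.ε ∈ B
    ε∈B = proj₁ B-subgroup

    ∙∈B : ∀ {x y} → x ∈ B → y ∈ B → x A.∙ y ∈ B
    ∙∈B = proj₁ (proj₂ B-subgroup) _ _

    ⁻¹∈B : ∀ {x} → x ∈ B → x A.⁻¹ ∈ B
    ⁻¹∈B = proj₂ (proj₂ B-subgroup) _

  infix 4 _~_
  _~_ : Fin (order A) → Fin (order A) → Set
  x ~ y = x \\ y ∈ B

  ~-refl : ∀ {x} → x ~ x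
  ~-refl {x} = subst (_∈ B) (sym (A.inverseˡ x)) ε∈B

  ~-sym : ∀ {x y} → x ~ y → y ~ x
  ~-sym {x} {y} x~y = subst (_∈ B) (⁻¹-anti-homo-\\ x y) (⁻¹∈B x~y)

  ~-trans : ∀ {x y z} → x ~ y → y ~ z → x ~ z
  ~-trans {x} {y} {z} x~y y~z = subst (_∈ B) telescope (∙∈B x~y y~z)
    where
    telescope : (x \\ y) A.∙ (y \\ z) ≡ x \\ z
    telescope = trans (A.assoc _ _ _) (cong (x A.⁻¹ A.∙_) (\\-leftDividesˡ y z))

  ~-∙-cong : ∀ {x x′ y y′} → x ~ x′ → y ~ y′ → x A.∙ y ~ x′ A.∙ y′
  ~-∙-cong {x} {x′} {y} {y′} x~x′ y~y′ = subst (_∈ B) regroup (∙∈B x~x′ y~y′)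
    where
    regroup : (x \\ x′) A.∙ (y \\ y′) ≡ (x A.∙ y) \\ (x′ A.∙ y′)
    regroup = trans (interchange _ _ _ _) (cong (A._∙ (x′ A.∙ y′)) (⁻¹-∙-comm x y))

  y∈B⇒x~x∙y : ∀ {x y} → y ∈ B → x ~ x A.∙ y
  y∈B⇒x~x∙y {x} {y} y∈B = subst (_∈ B) (sym (\\-leftDividesʳ x y)) y∈B

  ε~x⇔x∈B : ∀ {x} → A.ε ~ x ⇔ x ∈ B
  ε~x⇔x∈B {x} = mk⇔ (subst (_∈ B) ε\\x≡x) (subst (_∈ B) (sym ε\\x≡x))
    where
    ε\\x≡x : A.ε \\ x ≡ x
    ε\\x≡x = trans (cong (A._∙ x) ε⁻¹≈ε) (A.identityˡ x)

  ~-decSetoid : DecSetoid 0ℓ 0ℓ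
  ~-decSetoid = record
    { Carrier = Fin (order A) ; _≈_ = _~_
    ; isDecEquivalence = record
      { isEquivalence = record { refl = ~-refl ; sym = ~-sym ; trans = ~-trans }
      ; _≟_ = λ x y → x \\ y ∈? B } }

  -- A/B lives on Fin index: rep picks one element of each coset, class sends x to its coset.
  transversal : List (Fin (order A))
  transversal = deduplicate (DecSetoid._≟_ ~-decSetoid) (allFin (order A))

  index : ℕ
  index = length transversal

  rep : Fin index → Fin (order A)
  rep = lookup transversal

  rep-injective : ∀ {a b} → rep a ~ rep b → a ≡ b
  rep-injective = lookup-injective (DecSetoid.setoid ~-decSetoid) (deduplicate-! ~-decSetoid (allFin (order A)))

  private
    rep-of : ∀ x → Any (x ~_) transversal
    rep-of x = deduplicate⁺ (DecSetoid._≟_ ~-decSetoid) (λ z~y x~y → ~-trans x~y (~-sym z~y))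
                 (Any.map (λ { refl → ~-refl }) (∈-allFin x))

  class : Fin (order A) → Fin index
  class x = Any.index (rep-of x)

  ~-rep-class : ∀ x → x ~ rep (class x)
  ~-rep-class x = lookup-index (rep-of x)

  class-rep : ∀ a → class (rep a) ≡ a
  class-rep a = rep-injective (~-sym (~-rep-class (rep a)))

  ~⇒class≡ : ∀ {x y} → x ~ y → class x ≡ class y
  ~⇒class≡ {x} {y} x~y = rep-injective (~-trans (~-sym (~-rep-class x)) (~-trans x~y (~-rep-class y)))

  class≡⇒~ : ∀ {x y} → class x ≡ class y → x ~ y
  class≡⇒~ {x} {y} eq = ~-trans (~-rep-class x) (subst (λ a → rep a ~ y) (sym eq) (~-sym (~-rep-class y)))

  quotientGroup : FinAbGroup
  quotientGroup = inducedGroup A class rep class-rep (λ p q → ~⇒class≡ (~-∙-cong (class≡⇒~ p) (class≡⇒~ q)))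

  class-isHomomorphism : IsHomomorphism A quotientGroup class
  class-isHomomorphism = π-isHomomorphism A class rep class-rep _

  classx≡classε⇔x∈B : ∀ {x} → class x ≡ class A.ε ⇔ x ∈ B
  classx≡classε⇔x∈B = mk⇔ (Equivalence.to ε~x⇔x∈B ∘ ~-sym ∘ class≡⇒~)
                         (sym ∘ ~⇒class≡ ∘ Equivalence.from ε~x⇔x∈B)

  lagrange : index * ∣ B ∣ ≤ order A
  lagrange = *-injective⇒≤ (λ a b → rep a A.∙ enumerate B b) injective
    where
    same-coset : ∀ {a b a′ b′} → rep a A.∙ enumerate B b ≡ rep a′ A.∙ enumerate B b′ → rep a ~ rep a′
    same-coset {b = b} {a′} {b′} eq = ~-trans (y∈B⇒x~x∙y (enumerate-∈ B b))
      (subst (_~ rep a′) (sym eq) (~-sym (y∈B⇒x~x∙y (enumerate-∈ B b′))))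

    injective : ∀ {a b a′ b′} → rep a A.∙ enumerate B b ≡ rep a′ A.∙ enumerate B b′ → a ≡ a′ × b ≡ b′
    injective {a} eq with refl ← rep-injective (same-coset eq) =
      refl , enumerate-injective B (∙-cancelˡ (rep a) _ _ eq)

  index≤ : ∀ {d} → order A ≤ d * ∣ B ∣ → index ≤ d
  index≤ {d} |A|≤d|B| = *-cancelʳ-≤ index d ∣ B ∣ {{>-nonZero ∣B∣≥1}} (≤-trans lagrange |A|≤d|B|)
    where
    ∣B∣≥1 : 1 ≤ ∣ B ∣
    ∣B∣≥1 = subst (_≤ ∣ B ∣) (∣⁅x⁆∣≡1 A.ε)
              (p⊆q⇒∣p∣≤∣q∣ (λ x∈⁅ε⁆ → subst (_∈ B) (sym (x∈⁅y⁆⇒x≡y A.ε x∈⁅ε⁆)) ε∈B))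

module _ {d : ℕ} {reps : List FinAbGroup} (reps-bounded : All (λ G → order G ≤ d) reps)
         (A : FinAbGroup) where

  record QuotientIn (B : Subset (order A)) : Set where
    constructor quotientIn
    field
      i : Fin (length reps)
      φ : Fin (order A) → Fin (order (lookup reps i))
      φ-isHomomorphism : IsHomomorphism A (lookup reps i) φ
      kernel : ∀ {x} → φ x ≡ φ (ε A) ⇔ x ∈ B

  ≅-quotientIn : ∀ {G B π} → IsHomomorphism A G π → (∀ {x} → π x ≡ π (ε A) ⇔ x ∈ B) →
                 ∀ {i} → G ≅ lookup reps i → QuotientIn B
  ≅-quotientIn {π = π} π-homo π-kernel {i} (f , g , g∘f , _ , f-∙-homo) =
    quotientIn i (f ∘ π) (∘-isHomomorphism (isHomomorphism f-∙-homo) π-homo)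
      (mk⇔ (Equivalence.to π-kernel ∘ f-injective) (cong f ∘ Equivalence.from π-kernel))
    where
    f-injective : ∀ {a b} → f a ≡ f b → a ≡ b
    f-injective {a} {b} fa≡fb = trans (sym (g∘f a)) (trans (cong g fa≡fb) (g∘f b))

  subgroup⇒quotientIn : (∀ G → order G ≤ d → Any (G ≅_) reps) →
                        ∀ {B} → IsSubgroup A B → order A ≤ d * ∣ B ∣ → QuotientIn B
  subgroup⇒quotientIn complete B-subgroup |A|≤d|B| =
    ≅-quotientIn class-isHomomorphism classx≡classε⇔x∈B (lookup-index (complete quotientGroup (index≤ |A|≤d|B|)))
    where open Quotient A B-subgroup

  module _ {gs : List (Fin (order A))} (generates : ∀ x → InGenerated A gs x) where

    code : ∀ {B} → QuotientIn B → Fin (length reps * d ^ length gs)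
    code (quotientIn i φ _ _) =
      combine i (funToFin λ j → inject≤ (φ (lookup gs j)) (All.lookup reps-bounded (∈-lookup i)))

    code-injective : ∀ {B B′} (Q : QuotientIn B) (Q′ : QuotientIn B′) → code Q ≡ code Q′ → B ≡ B′
    code-injective (quotientIn i φ φ-homo φ-kernel) (quotientIn i′ ψ ψ-homo ψ-kernel) code≡
      with refl ← combine-injectiveˡ i _ i′ _ code≡ =
      ⊆-antisym (kernel-⊆ φ-kernel ψ-kernel φ≗ψ) (kernel-⊆ ψ-kernel φ-kernel (sym ∘ φ≗ψ))
      where
      φ≡ψ-on-generators : ∀ j → φ (lookup gs j) ≡ ψ (lookup gs j)
      φ≡ψ-on-generators j = inject≤-injective _ _ _ _ (begin
        _   ≡⟨ finToFun-funToFin _ j ⟨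
        _   ≡⟨ cong (λ c → finToFun c j) (combine-injectiveʳ i _ i _ code≡) ⟩
        _   ≡⟨ finToFun-funToFin _ j ⟩
        _   ∎)
        where open ≡-Reasoning

      φ≗ψ : ∀ x → φ x ≡ ψ x
      φ≗ψ x = agree-on-generated φ-homo ψ-homo
        (All.tabulate λ g∈gs → subst (λ g → φ g ≡ ψ g) (sym (lookup-index g∈gs)) (φ≡ψ-on-generators (Any.index g∈gs)))
        (generates x)

      kernel-⊆ : ∀ {C D : Subset (order A)} {χ ω : Fin (order A) → Fin (order (lookup reps i))} →
                 (∀ {x} → χ x ≡ χ (ε A) ⇔ x ∈ C) → (∀ {x} → ω x ≡ ω (ε A) ⇔ x ∈ D) →
                 (∀ x → χ x ≡ ω x) → C ⊆ D
      kernel-⊆ χ-kernel ω-kernel χ≗ω x∈C = Equivalence.to ω-kernel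
        (trans (sym (χ≗ω _)) (trans (Equivalence.from χ-kernel x∈C) (χ≗ω _)))

lemma2p1 : (n d : ℕ) → n ≥ 1 → d ≥ 1 →
    (reps : List FinAbGroup) → IsoClassReps d reps →
    (A : FinAbGroup) → RankAtMost n A →
    (Bs : List (Subset (order A))) → SubgroupsOfIndexAtMost d A Bs →
    length Bs ≤ d ^ n * length reps
lemma2p1 n d _ d≥1 reps (reps-bounded , _ , complete) A (gs , |gs|≤n , generates) Bs (Bs! , Bs-index≤d) =
  begin
    length Bs                   ≤⟨ unique-length≤ (code reps-bounded A generates ∘ quotient)
                                     (λ p q → code-injective reps-bounded A generates (quotient p) (quotient q))
                                     Bs! Bs-index≤d ⟩
    length reps * d ^ length gs ≤⟨ *-monoʳ-≤ (length reps) (^-monoʳ-≤ d {{>-nonZero d≥1}} |gs|≤n) ⟩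
    length reps * d ^ n         ≡⟨ *-comm (length reps) (d ^ n) ⟩
    d ^ n * length reps         ∎
  where
  open ≤-Reasoning
  quotient : ∀ {B} → IsSubgroup A B × order A ≤ d * ∣ B ∣ → QuotientIn reps-bounded A B
  quotient (B-subgroup , |A|≤d|B|) = subgroup⇒quotientIn reps-bounded A complete B-subgroup |A|≤d|B|
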